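{- Let $d\ge1$, let $h$ be an integer with $0\le h\le d-1$, let $n\ge1$, and let $u_n(x)$ be the number of times $x\in\mathbb{Z}^d$ topples during the stabilization of $\overline{h}+n\delta_o$. Let $\rho>0$ be real and $c\ge0$ an integer such that $u_n(x)\le c$ for all $x\in\mathbb{Z}^d$ with $|x|>\rho-1$. Then for all $j=0,1,\ldots,c$ and all $x\in\mathbb{Z}^d$ with $|x|>\rho+j-1$, we have $u_n(x)\le c-j$. (In particular $u_n$ vanishes on $\{|x|>\rho+c-1\}$.)
   Context: Abelian sandpile on $\mathbb{Z}^d$: a site with at least $2d$ particles is unstable and may topple, sending one particle to each of its $2d$ lattice neighbours; $\overline{h}+n\delta_o$ is the configuration with $h$ particles at every site plus $n$ extra particles at the origin. It stabilizes after finitely many topplings at each site, and the number of topplings at each site (the odometer $u_n$) does not depend on the legal toppling order. $|x|$ is the Euclidean norm. In the paper, $\rho=c_1' r$ with $n=\omega_d r^d$ and $c_1'=(d-\epsilon-h)^{ -1/d}$, and $c$ is a constant (depending on $d,h,\epsilon$ but not $n$) for which the hypothesis holds.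
   Formalization: The parameter ρ ranges over the positive rationals instead of the positive reals. -}

module Defs where

open import Data.Nat as ℕ using (ℕ; _≤_; _<_)
open import Data.Integer as ℤ using (ℤ; +_; ∣_∣)
import Data.Integer.Properties as ℤP
open import Data.Rational as ℚ using (ℚ)
open import Data.Vec using (Vec; []; _∷_; replicate; zipWith; foldr)
open import Data.Vec.Properties using (≡-dec)
open import Data.List using (List; []; _∷_; filter; length)
open import Data.Sum using (_⊎_)
open import Relation.Nullary using (yes; no; Dec)
open import Relation.Binary.PropositionalEquality using (_≡_)
open import Relation.Binary using (DecidableEquality)

Point : ℕ → Set
Point d = Vec ℤ d

_≟P_ : ∀ {d} → DecidableEquality (Point d)
_≟P_ = ≡-dec ℤ._≟_

origin : (d : ℕ) → Point d
origin d = replicate d (+ 0)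

l1dist : ∀ {d} → Point d → Point d → ℕ
l1dist x y = foldr (λ _ → ℕ) ℕ._+_ 0 (zipWith (λ a b → ∣ a ℤ.- b ∣) x y)

normSq : ∀ {d} → Point d → ℕ
normSq x = foldr (λ _ → ℕ) ℕ._+_ 0 (Data.Vec.map (λ a → ∣ a ∣ ℕ.* ∣ a ∣) x)
  where import Data.Vec

-- |x| > q  (for rational q), where |x| is the Euclidean norm:
-- either q < 0, or q² < |x|²
NormGt : ∀ {d} → Point d → ℚ → Set
NormGt x q = (q ℚ.< ℚ.0ℚ) ⊎ (q ℚ.* q ℚ.< (+ normSq x) ℚ./ 1)

-- sandpile configurations (particle counts; ℤ-valued for convenience)
Config : ℕ → Set
Config d = Point d → ℤ

initial : (d h n : ℕ) → Config d
initial d h n x with x ≟P origin d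
... | yes _ = + (h ℕ.+ n)
... | no _  = + h

topple : ∀ {d} → Point d → Config d → Config d
topple {d} x η y = η y ℤ.- loss ℤ.+ gain
  where
  loss : ℤ
  loss with y ≟P x
  ... | yes _ = + (2 ℕ.* d)
  ... | no _  = + 0
  gain : ℤ
  gain with l1dist y x ℕ.≟ 1
  ... | yes _ = + 1
  ... | no _  = + 0

data LegalRun {d : ℕ} : Config d → List (Point d) → Config d → Set where
  done : ∀ {η} → LegalRun η [] η
  step : ∀ {η x xs η'} → + (2 ℕ.* d) ℤ.≤ η x →
         LegalRun (topple x η) xs η' → LegalRun η (x ∷ xs) η'

Stable : ∀ {d} → Config d → Set
Stable {d} η = ∀ x → η x ℤ.< + (2 ℕ.* d)

topplings : ∀ {d} → List (Point d) → Point d → ℕ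
topplings xs x = length (filter (_≟P x) xs)

{-# OPTIONS --safe #-}
module Submission where

-- Let K = c - j - 1 and R = {x : |x| > ρ + j}. Along every axis a site
-- x ∈ R has one neighbour in R (the one farther from the origin) and one neighbour y with
-- |y| > ρ + j - 1, which by induction topples at most K + 1 times. Consider the first
-- moment at which some x ∈ R is about to topple for the (K+1)-th time. Up to then x has
-- received at most d(K + (K+1)) particles and sent away 2dK, and it started with h ≤ d - 1
-- (x ≠ o since ρ > 0), so it holds at most 2d - 1 particles and cannot topple.

module Roots where
  open import Data.Nat as ℕ using (ℕ; suc)
  import Data.Nat.Properties as ℕP
  open import Data.Nat.Solver using (module +-*-Solver)
  open import Data.Integer as ℤ using (+_)
  import Data.Integer.Properties as ℤP
  import Data.Nat.Coprimality as Coprime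
  open import Data.Rational as ℚ using (ℚ; mkℚ; _<_; _≤_; _+_; _*_; 0ℚ; 1ℚ; _/_)
  import Data.Rational.Properties as ℚP
  import Data.Rational.Solver as ℚSolver
  open import Data.Sum using (_⊎_; inj₁; inj₂)
  open import Relation.Nullary using (¬_; yes; no)
  open import Relation.Binary.PropositionalEquality

  toℚ : ℕ → ℚ
  toℚ n = + n / 1

  private
    toℚ-normal : ∀ n → toℚ n ≡ mkℚ (+ n) 0 (Coprime.sym (Coprime.1-coprimeTo n))
    toℚ-normal n = ℚP.normalize-coprime (Coprime.sym (Coprime.1-coprimeTo n))

  toℚ-mono-≤ : ∀ {m n} → m ℕ.≤ n → toℚ m ≤ toℚ n
  toℚ-mono-≤ {m} {n} m≤n rewrite toℚ-normal m | toℚ-normal n =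
    ℚ.*≤* (subst₂ ℤ._≤_ (sym (ℤP.*-identityʳ (+ m))) (sym (ℤP.*-identityʳ (+ n))) (ℤ.+≤+ m≤n))

  toℚ-homo-+ : ∀ m n → toℚ (m ℕ.+ n) ≡ toℚ m + toℚ n
  toℚ-homo-+ m n rewrite toℚ-normal m | toℚ-normal n =
    ℚP./-cong (trans (ℤP.pos-+ m n) (sym (cong₂ ℤ._+_ (ℤP.*-identityʳ (+ m)) (ℤP.*-identityʳ (+ n))))) refl

  toℚ-homo-* : ∀ m n → toℚ (m ℕ.* n) ≡ toℚ m * toℚ n
  toℚ-homo-* m n rewrite toℚ-normal m | toℚ-normal n = ℚP./-cong (ℤP.pos-* m n) refl

  infix 4 √_>_

  -- NormGt x q unfolds to √ normSq x > q.
  √_>_ : ℕ → ℚ → Set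
  √ N > q = q < 0ℚ ⊎ q * q < toℚ N

  √>-mono-≤ : ∀ {M N q} → M ℕ.≤ N → √ M > q → √ N > q
  √>-mono-≤ _   (inj₁ q<0)   = inj₁ q<0
  √>-mono-≤ M≤N (inj₂ q²<M) = inj₂ (ℚP.<-≤-trans q²<M (toℚ-mono-≤ M≤N))

  ¬√0> : ∀ {q} → 0ℚ ≤ q → ¬ (√ 0 > q)
  ¬√0> 0≤q (inj₁ q<0)  = ℚP.<-irrefl refl (ℚP.<-≤-trans q<0 0≤q)
  ¬√0> {q} 0≤q (inj₂ q²<0) = ℚP.<-irrefl refl (ℚP.<-≤-trans q²<0 0≤q²)
    where
    instance _ = ℚ.nonNegative 0≤q
    0≤q² : 0ℚ ≤ q * q
    0≤q² = ℚP.nonNegative⁻¹ (q * q) {{ℚP.nonNeg*nonNeg⇒nonNeg q q}}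

  private
    square-suc : ∀ R b → R ℕ.+ suc b ℕ.* suc b ≡ (R ℕ.+ b ℕ.* b) ℕ.+ ((b ℕ.+ b) ℕ.+ 1)
    square-suc = solve 2 (λ R b → R :+ (con 1 :+ b) :* (con 1 :+ b) := (R :+ b :* b) :+ ((b :+ b) :+ con 1)) refl
      where open +-*-Solver

    q<q+1 : ∀ q → q < q + 1ℚ
    q<q+1 q = subst (_< q + 1ℚ) (ℚP.+-identityʳ q) (ℚP.+-monoʳ-< q (ℚP.positive⁻¹ 1ℚ))

  √>-step : ∀ {R a b q} → a ℕ.≤ suc b → √ (R ℕ.+ a ℕ.* a) > q + 1ℚ → √ (R ℕ.+ b ℕ.* b) > q
  √>-step {q = q} _ (inj₁ q+1<0) = inj₁ (ℚP.<-trans (q<q+1 q) q+1<0)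
  √>-step {R} {a} {b} {q} a≤1+b (inj₂ [q+1]²<N) with q ℚP.<? 0ℚ
  ... | yes q<0 = inj₁ q<0
  ... | no  q≮0 = inj₂ (ℚP.≰⇒> M≰q²)
    where
    open ℚP.≤-Reasoning
    B = toℚ b
    M = toℚ (R ℕ.+ b ℕ.* b)
    instance _ = ℚ.nonNegative (ℚP.≮⇒≥ q≮0)

    M≰q² : ¬ (M ≤ q * q)
    M≰q² M≤q² with q ℚP.<? B
    ... | yes q<B = ℚP.<-irrefl refl (begin-strict
      q * q  ≤⟨ ℚP.*-monoˡ-≤-nonNeg q (ℚP.<⇒≤ q<B) ⟩
      q * B  <⟨ ℚP.*-monoˡ-<-pos B q<B ⟩
      B * B  ≡⟨ toℚ-homo-* b b ⟨
      toℚ (b ℕ.* b)  ≤⟨ toℚ-mono-≤ (ℕP.m≤n+m (b ℕ.* b) R) ⟩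
      M      ≤⟨ M≤q² ⟩
      q * q  ∎)
      where instance _ = ℚ.positive (ℚP.≤-<-trans (ℚP.≮⇒≥ q≮0) q<B)
    ... | no q≮B = ℚP.<-irrefl refl (begin-strict
      (q + 1ℚ) * (q + 1ℚ)             <⟨ [q+1]²<N ⟩
      toℚ (R ℕ.+ a ℕ.* a)             ≤⟨ toℚ-mono-≤ (ℕP.+-monoʳ-≤ R (ℕP.*-mono-≤ a≤1+b a≤1+b)) ⟩
      toℚ (R ℕ.+ suc b ℕ.* suc b)     ≡⟨ cong toℚ (square-suc R b) ⟩
      toℚ ((R ℕ.+ b ℕ.* b) ℕ.+ ((b ℕ.+ b) ℕ.+ 1))
                                      ≡⟨ toℚ-homo-+ (R ℕ.+ b ℕ.* b) _ ⟩
      M + toℚ ((b ℕ.+ b) ℕ.+ 1)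
                                      ≡⟨ cong (λ t → M + t) (trans (toℚ-homo-+ (b ℕ.+ b) 1) (cong (_+ 1ℚ) (toℚ-homo-+ b b))) ⟩
      M + ((B + B) + 1ℚ)
                                      ≤⟨ ℚP.+-mono-≤ M≤q² (ℚP.+-monoˡ-≤ 1ℚ (ℚP.+-mono-≤ B≤q B≤q)) ⟩
      q * q + ((q + q) + 1ℚ)
                                      ≡⟨ solve 1 (λ x → x :* x :+ ((x :+ x) :+ con 1ℚ) := (x :+ con 1ℚ) :* (x :+ con 1ℚ)) refl q ⟩
      (q + 1ℚ) * (q + 1ℚ)             ∎)
      where
      open ℚSolver.+-*-Solver
      B≤q = ℚP.≮⇒≥ q≮B

module Lattice where
  open import Defs
  open Roots using (√_>_; √>-mono-≤; √>-step; ¬√0>)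
  import Data.Rational as ℚ
  open import Data.Nat as ℕ using (zero; suc; _≤_; z≤n)
  import Data.Nat.Properties as ℕP
  open import Data.Integer as ℤ using (+_; -[1+_]; ∣_∣; 0ℤ; 1ℤ; -1ℤ)
  import Data.Integer.Properties as ℤP
  import Data.Integer.Solver as ℤSolver
  open import Data.Fin using (Fin; zero; suc)
  open import Data.Vec using ([]; _∷_; lookup; updateAt)
  open import Data.Vec.Properties using (updateAt-id)
  open import Data.Product using (∃; _,_)
  open import Data.Sum using (_⊎_; inj₁; inj₂; map; [_,_]′)
  open import Function using (id; const; _∘_)
  open import Relation.Nullary using (¬_)
  open import Relation.Binary.PropositionalEquality

  up down : ∀ {d} → Fin d → Point d → Point d
  up   i x = updateAt x i ℤ.suc
  down i x = updateAt x i ℤ.pred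

  normSq-updateAt : ∀ {d} (x : Point d) i f →
    normSq (updateAt x i f) ≡ normSq (updateAt x i (const 0ℤ)) ℕ.+ ∣ f (lookup x i) ∣ ℕ.* ∣ f (lookup x i) ∣
  normSq-updateAt (a ∷ x) zero    f = ℕP.+-comm _ (normSq x)
  normSq-updateAt (a ∷ x) (suc i) f = trans (cong (∣ a ∣ ℕ.* ∣ a ∣ ℕ.+_) (normSq-updateAt x i f))
    (sym (ℕP.+-assoc (∣ a ∣ ℕ.* ∣ a ∣) (normSq (updateAt x i (const 0ℤ))) _))

  normSq-origin : ∀ d → normSq (origin d) ≡ 0
  normSq-origin zero    = refl
  normSq-origin (suc d) = normSq-origin d

  ¬NormGt-origin : ∀ d {q} → ℚ.0ℚ ℚ.≤ q → ¬ NormGt (origin d) q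
  ¬NormGt-origin d {q} 0≤q = ¬√0> 0≤q ∘ subst (√_> q) (normSq-origin d)

  normSq-split : ∀ {d} (x : Point d) i →
    normSq x ≡ normSq (updateAt x i (const 0ℤ)) ℕ.+ ∣ lookup x i ∣ ℕ.* ∣ lookup x i ∣
  normSq-split x i = trans (cong normSq (sym (updateAt-id i x))) (normSq-updateAt x i id)

  NormGt-updateAt-mono : ∀ {d} (x : Point d) i f {q} → ∣ lookup x i ∣ ≤ ∣ f (lookup x i) ∣ →
    NormGt x q → NormGt (updateAt x i f) q
  NormGt-updateAt-mono x i f {q} a≤b |x|>q = subst (√_> q) (sym (normSq-updateAt x i f))
    (√>-mono-≤ (ℕP.+-monoʳ-≤ (normSq (updateAt x i (const 0ℤ))) (ℕP.*-mono-≤ a≤b a≤b))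
      (subst (√_> q) (normSq-split x i) |x|>q))

  NormGt-updateAt-step : ∀ {d} (x : Point d) i f {q} → ∣ lookup x i ∣ ≤ suc ∣ f (lookup x i) ∣ →
    NormGt x (q ℚ.+ ℚ.1ℚ) → NormGt (updateAt x i f) q
  NormGt-updateAt-step x i f {q} a≤1+b |x|>q+1 = subst (√_> q) (sym (normSq-updateAt x i f))
    (√>-step {normSq (updateAt x i (const 0ℤ))} a≤1+b (subst (√_> q ℚ.+ ℚ.1ℚ) (normSq-split x i) |x|>q+1))

  ∣i∣≤∣suc[i]∣⊎∣i∣≤∣pred[i]∣ : ∀ i → ∣ i ∣ ≤ ∣ ℤ.suc i ∣ ⊎ ∣ i ∣ ≤ ∣ ℤ.pred i ∣
  ∣i∣≤∣suc[i]∣⊎∣i∣≤∣pred[i]∣ (+ n)      = inj₁ (ℕP.n≤1+n n)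
  ∣i∣≤∣suc[i]∣⊎∣i∣≤∣pred[i]∣ -[1+ n ]   = inj₂ (ℕP.n≤1+n (suc n))

  ∣i∣≤1+∣suc[i]∣ : ∀ i → ∣ i ∣ ≤ suc ∣ ℤ.suc i ∣
  ∣i∣≤1+∣suc[i]∣ (+ n)            = ℕP.m≤n+m n 2
  ∣i∣≤1+∣suc[i]∣ -[1+ zero ]      = ℕP.≤-refl
  ∣i∣≤1+∣suc[i]∣ -[1+ suc n ]     = ℕP.≤-refl

  ∣i∣≤1+∣pred[i]∣ : ∀ i → ∣ i ∣ ≤ suc ∣ ℤ.pred i ∣
  ∣i∣≤1+∣pred[i]∣ (+ zero)        = z≤n
  ∣i∣≤1+∣pred[i]∣ (+ suc n)       = ℕP.≤-refl
  ∣i∣≤1+∣pred[i]∣ -[1+ n ]        = ℕP.m≤n+m (suc n) 2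

  NormGt-up⊎down : ∀ {d q} (x : Point d) → NormGt x q → ∀ i → NormGt (up i x) q ⊎ NormGt (down i x) q
  NormGt-up⊎down x |x|>q i with ∣i∣≤∣suc[i]∣⊎∣i∣≤∣pred[i]∣ (lookup x i)
  ... | inj₁ ≤suc  = inj₁ (NormGt-updateAt-mono x i ℤ.suc ≤suc |x|>q)
  ... | inj₂ ≤pred = inj₂ (NormGt-updateAt-mono x i ℤ.pred ≤pred |x|>q)

  NormGt-up : ∀ {d} (x : Point d) i {q} → NormGt x (q ℚ.+ ℚ.1ℚ) → NormGt (up i x) q
  NormGt-up x i = NormGt-updateAt-step x i ℤ.suc (∣i∣≤1+∣suc[i]∣ (lookup x i))

  NormGt-down : ∀ {d} (x : Point d) i {q} → NormGt x (q ℚ.+ ℚ.1ℚ) → NormGt (down i x) q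
  NormGt-down x i = NormGt-updateAt-step x i ℤ.pred (∣i∣≤1+∣pred[i]∣ (lookup x i))

  l1dist≡0⇒≡ : ∀ {d} (x z : Point d) → l1dist x z ≡ 0 → x ≡ z
  l1dist≡0⇒≡ []      []      _ = refl
  l1dist≡0⇒≡ (a ∷ x) (b ∷ z) e = cong₂ _∷_
    (ℤP.i-j≡0⇒i≡j a b (ℤP.∣i∣≡0⇒i≡0 (ℕP.m+n≡0⇒m≡0 ∣ a ℤ.- b ∣ e)))
    (l1dist≡0⇒≡ x z (ℕP.m+n≡0⇒n≡0 ∣ a ℤ.- b ∣ e))

  ∣i∣≡1⇒i≡1⊎i≡-1 : ∀ i → ∣ i ∣ ≡ 1 → i ≡ 1ℤ ⊎ i ≡ -1ℤ
  ∣i∣≡1⇒i≡1⊎i≡-1 (+ .1)       refl = inj₁ refl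
  ∣i∣≡1⇒i≡1⊎i≡-1 -[1+ zero ]  refl = inj₂ refl

  ∣i-j∣≡1⇒j≡suc[i]⊎j≡pred[i] : ∀ i j → ∣ i ℤ.- j ∣ ≡ 1 → j ≡ ℤ.suc i ⊎ j ≡ ℤ.pred i
  ∣i-j∣≡1⇒j≡suc[i]⊎j≡pred[i] i j e = [ inj₂ ∘ via , inj₁ ∘ via ]′ (∣i∣≡1⇒i≡1⊎i≡-1 (i ℤ.- j) e)
    where
    open ℤSolver.+-*-Solver
    via : ∀ {k} → i ℤ.- j ≡ k → j ≡ ℤ.- k ℤ.+ i
    via refl = solve 2 (λ i j → j := :- (i :- j) :+ i) refl i j

  l1dist≡1⇒up⊎down : ∀ {d} (x z : Point d) → l1dist x z ≡ 1 → ∃ λ i → z ≡ up i x ⊎ z ≡ down i x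
  l1dist≡1⇒up⊎down []      []      ()
  l1dist≡1⇒up⊎down (a ∷ x) (b ∷ z) e with ∣ a ℤ.- b ∣ in ∣a-b∣
  ... | zero with l1dist≡1⇒up⊎down x z e
  ...   | i , z≡x± = suc i , map (cong₂ _∷_ b≡a) (cong₂ _∷_ b≡a) z≡x±
    where b≡a = sym (ℤP.i-j≡0⇒i≡j a b (ℤP.∣i∣≡0⇒i≡0 ∣a-b∣))
  l1dist≡1⇒up⊎down (a ∷ x) (b ∷ z) e | suc zero =
    zero , map (λ b≡ → cong₂ _∷_ b≡ z≡x) (λ b≡ → cong₂ _∷_ b≡ z≡x)
                (∣i-j∣≡1⇒j≡suc[i]⊎j≡pred[i] a b ∣a-b∣)
    where z≡x = sym (l1dist≡0⇒≡ x z (ℕP.suc-injective e))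

module Odometer where
  open import Defs
  open Lattice using (up; down; l1dist≡1⇒up⊎down)
  open import Data.Nat as ℕ using (ℕ; zero; suc; _≤_; z≤n)
  import Data.Nat.Properties as ℕP
  open import Data.Integer as ℤ using (ℤ; +_)
  import Data.Integer.Properties as ℤP
  import Data.Integer.Solver as ℤSolver
  open import Data.Nat.Solver using (module +-*-Solver)
  import Algebra.Properties.CommutativeSemigroup as CommSemigroup
  open CommSemigroup ℤP.+-commutativeSemigroup using (xy∙z≈xz∙y; xy∙z≈x∙zy)
  module ℕ+ = CommSemigroup ℕP.+-commutativeSemigroup
  open import Algebra.Properties.CommutativeMonoid.Sum ℕP.+-0-commutativeMonoid
    using (sum-syntax; ∑-distrib-+; sum-cong-≗)
  open import Data.Fin using (Fin; zero; suc)
  open import Function using (_∘_)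
  open import Data.List using (List; []; _∷_; filter; length; foldr)
  open import Data.Product using (_,_; _×_; proj₁; proj₂)
  open import Data.Sum using (_⊎_; inj₁; inj₂)
  open import Relation.Nullary using (Dec; yes; no; ¬_; contradiction)
  open import Relation.Unary using (Pred; Decidable)
  open import Relation.Binary using (DecidableEquality)
  open import Relation.Binary.PropositionalEquality

  𝟙 : ∀ {p} {P : Set p} → Dec P → ℕ
  𝟙 (yes _) = 1
  𝟙 (no _)  = 0

  𝟙-≟-sym : ∀ {a} {A : Set a} (_≟_ : DecidableEquality A) x y → 𝟙 (x ≟ y) ≡ 𝟙 (y ≟ x)
  𝟙-≟-sym _≟_ x y with x ≟ y | y ≟ x
  ... | yes _   | yes _   = refl
  ... | no  _   | no  _   = refl
  ... | yes x≡y | no  y≢x = contradiction (sym x≡y) y≢x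
  ... | no  x≢y | yes y≡x = contradiction (sym y≡x) x≢y

  𝟙-≡ : ∀ {a} {A : Set a} (_≟_ : DecidableEquality A) {x y} → x ≡ y → 𝟙 (x ≟ y) ≡ 1
  𝟙-≡ _≟_ {x} {y} x≡y with x ≟ y
  ... | yes _   = refl
  ... | no  x≢y = contradiction x≡y x≢y

  length-filter-∷ : ∀ {a p} {A : Set a} {P : Pred A p} (P? : Decidable P) x xs →
    length (filter P? (x ∷ xs)) ≡ 𝟙 (P? x) ℕ.+ length (filter P? xs)
  length-filter-∷ P? x xs with P? x
  ... | yes _ = refl
  ... | no  _ = refl

  ∑-≥ : ∀ {n} (f : Fin n → ℕ) i → f i ≤ ∑[ j < n ] f j
  ∑-≥ f zero    = ℕP.m≤m+n (f zero) _
  ∑-≥ f (suc i) = ℕP.≤-trans (∑-≥ (f ∘ suc) i) (ℕP.m≤n+m _ (f zero))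

  ∑-≤-* : ∀ {n} (f : Fin n → ℕ) {b} → (∀ i → f i ≤ b) → ∑[ i < n ] f i ≤ n ℕ.* b
  ∑-≤-* {zero}  f _   = z≤n
  ∑-≤-* {suc n} f f≤b = ℕP.+-mono-≤ (f≤b zero) (∑-≤-* (f ∘ suc) (f≤b ∘ suc))

  balance-compose : ∀ (t a b f g e n : ℤ) →
    t ℤ.+ a ≡ f ℤ.+ g → f ℤ.+ b ≡ e ℤ.+ n → t ℤ.+ (a ℤ.+ b) ≡ e ℤ.+ (g ℤ.+ n)
  balance-compose t a b f g e n t+a≡f+g f+b≡e+n = begin
    t ℤ.+ (a ℤ.+ b)  ≡⟨ ℤP.+-assoc t a b ⟨
    t ℤ.+ a ℤ.+ b    ≡⟨ cong (ℤ._+ b) t+a≡f+g ⟩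
    f ℤ.+ g ℤ.+ b    ≡⟨ xy∙z≈xz∙y f g b ⟩
    f ℤ.+ b ℤ.+ g    ≡⟨ cong (ℤ._+ g) f+b≡e+n ⟩
    e ℤ.+ n ℤ.+ g    ≡⟨ xy∙z≈x∙zy e n g ⟩
    e ℤ.+ (g ℤ.+ n)  ∎
    where open ≡-Reasoning

  module _ {d : ℕ} where

    neighbourTopplings : List (Point d) → Point d → ℕ
    neighbourTopplings zs y = length (filter (λ z → l1dist y z ℕ.≟ 1) zs)

    Unstable : Config d → Point d → Set
    Unstable η x = + (2 ℕ.* d) ℤ.≤ η x

    private
      i-j+k+j≡i+k : ∀ i j k {m} → m ≡ j → i ℤ.- + j ℤ.+ + k ℤ.+ + m ≡ i ℤ.+ + k
      i-j+k+j≡i+k i j k refl = solve 3 (λ a l g → a :- l :+ g :+ l := a :+ g) refl i (+ j) (+ k)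
        where open ℤSolver.+-*-Solver

    topple-conservation : ∀ (z : Point d) η y →
      topple z η y ℤ.+ + (2 ℕ.* d ℕ.* 𝟙 (y ≟P z)) ≡ η y ℤ.+ + 𝟙 (l1dist y z ℕ.≟ 1)
    topple-conservation z η y with y ≟P z | l1dist y z ℕ.≟ 1
    ... | yes _ | yes _ = i-j+k+j≡i+k (η y) (2 ℕ.* d) 1 (ℕP.*-identityʳ (2 ℕ.* d))
    ... | yes _ | no  _ = i-j+k+j≡i+k (η y) (2 ℕ.* d) 0 (ℕP.*-identityʳ (2 ℕ.* d))
    ... | no  _ | yes _ = i-j+k+j≡i+k (η y) 0 1 (ℕP.*-zeroʳ (2 ℕ.* d))
    ... | no  _ | no  _ = i-j+k+j≡i+k (η y) 0 0 (ℕP.*-zeroʳ (2 ℕ.* d))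

    topplings-∷ : ∀ (z : Point d) zs y → topplings (z ∷ zs) y ≡ 𝟙 (y ≟P z) ℕ.+ topplings zs y
    topplings-∷ z zs y = trans (length-filter-∷ (_≟P y) z zs) (cong (ℕ._+ topplings zs y) (𝟙-≟-sym _≟P_ z y))

    neighbourTopplings-∷ : ∀ (z : Point d) zs y →
      neighbourTopplings (z ∷ zs) y ≡ 𝟙 (l1dist y z ℕ.≟ 1) ℕ.+ neighbourTopplings zs y
    neighbourTopplings-∷ z zs y = length-filter-∷ (λ z → l1dist y z ℕ.≟ 1) z zs

    conservation : ∀ (η : Config d) zs y →
      foldr topple η zs y ℤ.+ + (2 ℕ.* d ℕ.* topplings zs y) ≡ η y ℤ.+ + neighbourTopplings zs y
    conservation η []       y = cong (λ t → η y ℤ.+ + t) (ℕP.*-zeroʳ (2 ℕ.* d))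
    conservation η (z ∷ zs) y = begin
      topple z η′ y ℤ.+ + (2 ℕ.* d ℕ.* topplings (z ∷ zs) y)
        ≡⟨ cong (λ t → topple z η′ y ℤ.+ t) sent ⟩
      topple z η′ y ℤ.+ (+ (2 ℕ.* d ℕ.* lost) ℤ.+ + (2 ℕ.* d ℕ.* topplings zs y))
        ≡⟨ balance-compose (topple z η′ y) (+ (2 ℕ.* d ℕ.* lost)) (+ (2 ℕ.* d ℕ.* topplings zs y))
             (η′ y) (+ gained) (η y) (+ neighbourTopplings zs y) (topple-conservation z η′ y) (conservation η zs y) ⟩
      η y ℤ.+ (+ gained ℤ.+ + neighbourTopplings zs y)
        ≡⟨ cong (λ t → η y ℤ.+ t) received ⟩
      η y ℤ.+ + neighbourTopplings (z ∷ zs) y ∎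
      where
      open ≡-Reasoning
      η′ = foldr topple η zs
      lost = 𝟙 (y ≟P z)
      gained = 𝟙 (l1dist y z ℕ.≟ 1)
      sent : + (2 ℕ.* d ℕ.* topplings (z ∷ zs) y) ≡ + (2 ℕ.* d ℕ.* lost) ℤ.+ + (2 ℕ.* d ℕ.* topplings zs y)
      sent = trans (cong (λ t → + (2 ℕ.* d ℕ.* t)) (topplings-∷ z zs y))
        (cong +_ (ℕP.*-distribˡ-+ (2 ℕ.* d) lost (topplings zs y)))
      received : + gained ℤ.+ + neighbourTopplings zs y ≡ + neighbourTopplings (z ∷ zs) y
      received = cong +_ (sym (neighbourTopplings-∷ z zs y))

    pairTopplings : List (Point d) → Point d → Fin d → ℕ
    pairTopplings zs x i = topplings zs (up i x) ℕ.+ topplings zs (down i x)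

    neighbourTopplings≤∑pairTopplings : ∀ zs x → neighbourTopplings zs x ≤ ∑[ i < d ] pairTopplings zs x i
    neighbourTopplings≤∑pairTopplings []       x = z≤n
    neighbourTopplings≤∑pairTopplings (z ∷ zs) x = begin
      neighbourTopplings (z ∷ zs) x                          ≡⟨ neighbourTopplings-∷ z zs x ⟩
      𝟙 (l1dist x z ℕ.≟ 1) ℕ.+ neighbourTopplings zs x
                                                             ≤⟨ ℕP.+-mono-≤ z-neighbour (neighbourTopplings≤∑pairTopplings zs x) ⟩
      ∑[ i < d ] hit i ℕ.+ ∑[ i < d ] pairTopplings zs x i  ≡⟨ ∑-distrib-+ hit (pairTopplings zs x) ⟨
      ∑[ i < d ] (hit i ℕ.+ pairTopplings zs x i)           ≡⟨ sum-cong-≗ pairTopplings-∷ ⟨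
      ∑[ i < d ] pairTopplings (z ∷ zs) x i                  ∎
      where
      open ℕP.≤-Reasoning
      hit : Fin d → ℕ
      hit i = 𝟙 (up i x ≟P z) ℕ.+ 𝟙 (down i x ≟P z)
      pairTopplings-∷ : ∀ i → pairTopplings (z ∷ zs) x i ≡ hit i ℕ.+ pairTopplings zs x i
      pairTopplings-∷ i = trans (cong₂ ℕ._+_ (topplings-∷ z zs (up i x)) (topplings-∷ z zs (down i x)))
        (ℕ+.interchange (𝟙 (up i x ≟P z)) _ (𝟙 (down i x ≟P z)) _)
      𝟙≥1 : ∀ {w} → z ≡ w → 1 ≤ 𝟙 (w ≟P z)
      𝟙≥1 z≡w = ℕP.≤-reflexive (sym (𝟙-≡ _≟P_ (sym z≡w)))
      z-neighbour : 𝟙 (l1dist x z ℕ.≟ 1) ≤ ∑[ i < d ] hit i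
      z-neighbour with l1dist x z ℕ.≟ 1
      ... | no  _ = z≤n
      ... | yes e with l1dist≡1⇒up⊎down x z e
      ...   | i , inj₁ z≡up   = ℕP.≤-trans (ℕP.≤-trans (𝟙≥1 z≡up) (ℕP.m≤m+n _ _)) (∑-≥ hit i)
      ...   | i , inj₂ z≡down = ℕP.≤-trans (ℕP.≤-trans (𝟙≥1 z≡down) (ℕP.m≤n+m _ _)) (∑-≥ hit i)

    ¬Unstable-after : ∀ (η : Config d) zs x {K} → η x ℤ.< + d → topplings zs x ≡ K →
      (∀ i → pairTopplings zs x i ≤ K ℕ.+ suc K) → ¬ Unstable (foldr topple η zs) x
    ¬Unstable-after η zs x {K} ηx<d refl pairs≤ unstable = ℤP.<-irrefl refl (begin-strict
      + (2 ℕ.* d) ℤ.+ + (2 ℕ.* d ℕ.* K)              ≤⟨ ℤP.+-monoˡ-≤ (+ (2 ℕ.* d ℕ.* K)) unstable ⟩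
      foldr topple η zs x ℤ.+ + (2 ℕ.* d ℕ.* K)      ≡⟨ conservation η zs x ⟩
      η x ℤ.+ + neighbourTopplings zs x             <⟨ ℤP.+-mono-<-≤ ηx<d (ℤ.+≤+ received≤) ⟩
      + d ℤ.+ + (d ℕ.* (K ℕ.+ suc K))               ≡⟨ cong +_ (solve 2 (λ d K → d :+ d :* (K :+ (con 1 :+ K))
                                                          := con 2 :* d :+ con 2 :* d :* K) refl d K) ⟩
      + (2 ℕ.* d) ℤ.+ + (2 ℕ.* d ℕ.* K)              ∎)
      where
      open ℤP.≤-Reasoning
      open +-*-Solver
      received≤ : neighbourTopplings zs x ≤ d ℕ.* (K ℕ.+ suc K)
      received≤ = ℕP.≤-trans (neighbourTopplings≤∑pairTopplings zs x) (∑-≤-* (pairTopplings zs x) pairs≤)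

    legalRun-topplings≤ : ∀ {η T η′} → LegalRun η T η′ → (R : Point d → Set) (K : ℕ) →
      (∀ zs x → R x → topplings zs x ≡ K → (∀ y → topplings zs y ≤ topplings T y) →
        (∀ y → R y → topplings zs y ≤ K) → ¬ Unstable (foldr topple η zs) x) →
      ∀ x → R x → topplings T x ≤ K
    legalRun-topplings≤ {η} {T} run R K never = go [] run (λ _ → refl) (λ _ _ → z≤n)
      where
      -- zs is the part of the run already performed, in reverse order: foldr topple η zs
      -- topples the last element of zs first.
      go : ∀ zs {xs η′} → LegalRun (foldr topple η zs) xs η′ →
        (∀ y → topplings zs y ℕ.+ topplings xs y ≡ topplings T y) →
        (∀ y → R y → topplings zs y ≤ K) → ∀ x → R x → topplings T x ≤ K
      go zs done split bounded x Rx =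
        subst (_≤ K) (trans (sym (ℕP.+-identityʳ (topplings zs x))) (split x)) (bounded x Rx)
      go zs (step {x = z} {xs} unstable run) split bounded = go (z ∷ zs) run split′ bounded′
        where
        split′ : ∀ y → topplings (z ∷ zs) y ℕ.+ topplings xs y ≡ topplings T y
        split′ y = begin
          topplings (z ∷ zs) y ℕ.+ topplings xs y               ≡⟨ cong (ℕ._+ topplings xs y) (topplings-∷ z zs y) ⟩
          𝟙 (y ≟P z) ℕ.+ topplings zs y ℕ.+ topplings xs y     ≡⟨ ℕ+.xy∙z≈y∙xz (𝟙 (y ≟P z)) (topplings zs y) (topplings xs y) ⟩
          topplings zs y ℕ.+ (𝟙 (y ≟P z) ℕ.+ topplings xs y)   ≡⟨ cong (topplings zs y ℕ.+_) (topplings-∷ z xs y) ⟨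
          topplings zs y ℕ.+ topplings (z ∷ xs) y               ≡⟨ split y ⟩
          topplings T y                                         ∎
          where open ≡-Reasoning
        below-T : ∀ y → topplings zs y ≤ topplings T y
        below-T y = subst (topplings zs y ≤_) (split y) (ℕP.m≤m+n _ _)
        bounded′ : ∀ y → R y → topplings (z ∷ zs) y ≤ K
        bounded′ y Ry rewrite topplings-∷ z zs y with y ≟P z
        ... | no  _    = bounded y Ry
        ... | yes refl with ℕP.m≤n⇒m<n∨m≡n (bounded y Ry)
        ...   | inj₁ below = below
        ...   | inj₂ atK   = contradiction unstable (never zs y Ry atK below-T bounded)

    shell-topplings≤ : ∀ {η T η′} → LegalRun η T η′ → (R : Point d → Set) (K : ℕ) →
      (∀ x → R x → η x ℤ.< + d) →
      (∀ x → R x → ∀ i → R (up i x) ⊎ R (down i x)) →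
      (∀ x → R x → ∀ i → topplings T (up i x) ≤ suc K × topplings T (down i x) ≤ suc K) →
      ∀ x → R x → topplings T x ≤ K
    shell-topplings≤ {η} {T} run R K sparse outward inner = legalRun-topplings≤ run R K stuck
      where
      stuck : ∀ zs x → R x → topplings zs x ≡ K → (∀ y → topplings zs y ≤ topplings T y) →
        (∀ y → R y → topplings zs y ≤ K) → ¬ Unstable (foldr topple η zs) x
      stuck zs x Rx atK below-T bounded = ¬Unstable-after η zs x (sparse x Rx) atK pairs≤
        where
        pairs≤ : ∀ i → pairTopplings zs x i ≤ K ℕ.+ suc K
        pairs≤ i with outward x Rx i
        ... | inj₁ R-up   = ℕP.+-mono-≤ (bounded (up i x) R-up)
          (ℕP.≤-trans (below-T (down i x)) (proj₂ (inner x Rx i)))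
        ... | inj₂ R-down = subst (pairTopplings zs x i ≤_) (ℕP.+-comm (suc K) K)
          (ℕP.+-mono-≤ (ℕP.≤-trans (below-T (up i x)) (proj₁ (inner x Rx i))) (bounded (down i x) R-down))

open import Defs
open import Data.Nat using (ℕ; _≤_; _∸_)
open import Data.Integer using (+_)
open import Data.Rational using (ℚ; _<_; _+_; _-_; 0ℚ; 1ℚ; _/_)
open import Data.List using (List)

open Roots using (toℚ; toℚ-mono-≤; toℚ-homo-+)
open Lattice using (up; down; ¬NormGt-origin; NormGt-up⊎down; NormGt-up; NormGt-down)
open Odometer using (shell-topplings≤)
import Data.Nat as ℕ
import Data.Nat.Properties as ℕP
import Data.Integer as ℤ
import Data.Rational as ℚ
import Data.Rational.Properties as ℚP
open import Data.Rational.Solver using (module +-*-Solver)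
open import Data.Product using (_,_; _×_)
open import Function using (_∘_)
open import Relation.Nullary using (yes; no; contradiction)
open import Relation.Binary.PropositionalEquality

private
  m∸n≡1+m∸[1+n] : ∀ {m n} → n ℕ.< m → m ∸ n ≡ ℕ.suc (m ∸ ℕ.suc n)
  m∸n≡1+m∸[1+n] {ℕ.suc m} {ℕ.zero}  _           = refl
  m∸n≡1+m∸[1+n] {ℕ.suc m} {ℕ.suc n} (ℕ.s≤s n<m) = m∸n≡1+m∸[1+n] n<m

  initial-≢origin : ∀ {d h n} {x : Point d} → x ≢ origin d → initial d h n x ≡ + h
  initial-≢origin {d} {x = x} x≢o with x ≟P origin d
  ... | yes x≡o = contradiction x≡o x≢o
  ... | no  _   = refl

  threshold-suc : ∀ ρ j → (ρ + toℚ (ℕ.suc j)) - 1ℚ ≡ ρ + toℚ j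
  threshold-suc ρ j = trans (cong (λ t → (ρ + t) - 1ℚ) (toℚ-homo-+ 1 j))
    (solve 2 (λ r J → (r :+ (con 1ℚ :+ J)) :- con 1ℚ := r :+ J) refl ρ (toℚ j))
    where open +-*-Solver

  threshold-pred : ∀ ρ j → ρ + toℚ j ≡ ((ρ + toℚ j) - 1ℚ) + 1ℚ
  threshold-pred ρ j = solve 2 (λ r J → r :+ J := ((r :+ J) :- con 1ℚ) :+ con 1ℚ) refl ρ (toℚ j)
    where open +-*-Solver

lemma3p2 : (d : ℕ) → 1 ≤ d → (h : ℕ) → h ≤ d ∸ 1 → (n : ℕ) → 1 ≤ n →
    (xs : List (Point d)) (η : Config d) →
    LegalRun (initial d h n) xs η → Stable η →
    (ρ : ℚ) → 0ℚ < ρ → (c : ℕ) →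
    (∀ x → NormGt x (ρ - 1ℚ) → topplings xs x ≤ c) →
    ∀ (j : ℕ) → j ≤ c → ∀ x → NormGt x ((ρ + (+ j / 1)) - 1ℚ) → topplings xs x ≤ c ∸ j
lemma3p2 d@(ℕ.suc _) _ h h≤d-1 n _ T _ run _ ρ 0<ρ c outer = bound
  where
  q : ℕ → ℚ
  q j = (ρ + toℚ j) - 1ℚ

  bound : ∀ j → j ≤ c → ∀ x → NormGt x (q j) → topplings T x ≤ c ∸ j
  bound ℕ.zero    _   x |x|>q = outer x (subst (NormGt x) (cong (_- 1ℚ) (ℚP.+-identityʳ ρ)) |x|>q)
  bound (ℕ.suc j) j<c =
    shell-topplings≤ run (λ x → NormGt x (q (ℕ.suc j))) (c ∸ ℕ.suc j) sparse NormGt-up⊎down inner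
    where
    q≥0 : 0ℚ ℚ.≤ q (ℕ.suc j)
    q≥0 = subst (0ℚ ℚ.≤_) (sym (threshold-suc ρ j))
      (ℚP.<⇒≤ (ℚP.+-mono-<-≤ 0<ρ (toℚ-mono-≤ {0} {j} ℕ.z≤n)))
    sparse : ∀ x → NormGt x (q (ℕ.suc j)) → initial d h n x ℤ.< + d
    sparse x |x|>q = subst (ℤ._< + d) (sym (initial-≢origin λ { refl → ¬NormGt-origin d q≥0 |x|>q }))
      (ℤ.+<+ (ℕ.s≤s h≤d-1))
    IH : ∀ y → NormGt y (q j) → topplings T y ≤ ℕ.suc (c ∸ ℕ.suc j)
    IH y = subst (topplings T y ≤_) (m∸n≡1+m∸[1+n] j<c) ∘ bound j (ℕP.<⇒≤ j<c) y
    inner : ∀ x → NormGt x (q (ℕ.suc j)) → ∀ i →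
      topplings T (up i x) ≤ ℕ.suc (c ∸ ℕ.suc j) × topplings T (down i x) ≤ ℕ.suc (c ∸ ℕ.suc j)
    inner x |x|>q i = IH (up i x) (NormGt-up x i |x|>q+1) , IH (down i x) (NormGt-down x i |x|>q+1)
      where |x|>q+1 = subst (NormGt x) (trans (threshold-suc ρ j) (threshold-pred ρ j)) |x|>q
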